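{- There are infinitely many pairwise non-isomorphic connected graphs $G$ with edge-connectivity $\kappa'(G)=1$ (that is, having a bridge) that admit an IRC-coloring.
   Context: Private neighbors. For $S\subseteq V(G)$ and $v\in S$, $pn[v,S]=N[v]\setminus\bigcup_{u\in S\setminus\{v\}}N[u]$, where $N[\cdot]$ is the closed neighborhood. $S$ is irredundant if $pn[v,S]\ne\emptyset$ for all $v\in S$. Rainbow committees and IRC-colorings. For a proper coloring of $G$ with nonempty color classes $V_1,\dots,V_k$, a rainbow committee is a set containing exactly one vertex of each color class. An irredundance compelling coloring (IRC-coloring) is a proper coloring in which every rainbow committee is an irredundant set. -}

module Defs where

open import Data.Nat using (ℕ)
open import Data.Fin using (Fin; _≟_)
open import Data.Bool using (Bool; true; false; _∧_; not)
open import Data.Product using (Σ; ∃; _×_; _,_)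
open import Data.Sum using (_⊎_)
open import Relation.Nullary using (¬_; ⌊_⌋)
open import Relation.Binary.PropositionalEquality using (_≡_; _≢_)
open import Function.Bundles using (_↔_; Inverse)

record Graph : Set where
  field
    order  : ℕ
    adj    : Fin order → Fin order → Bool
    sym    : ∀ u v → adj u v ≡ adj v u
    irrefl : ∀ v → adj v v ≡ false
open Graph public

_≅_ : Graph → Graph → Set
G ≅ H = Σ (Fin (order G) ↔ Fin (order H)) λ φ →
          ∀ u v → adj G u v ≡ adj H (Inverse.to φ u) (Inverse.to φ v)

data Walk (G : Graph) : Fin (order G) → Fin (order G) → Set where
  [] : ∀ {v} → Walk G v v
  _∷_ : ∀ {u w v} → adj G u w ≡ true → Walk G w v → Walk G u v

Connected : Graph → Set
Connected G = ∀ u v → Walk G u v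

deleteEdge : (G : Graph) → Fin (order G) → Fin (order G) → Graph
deleteEdge G a b = record
  { order  = order G
  ; adj    = λ x y → adj G x y ∧ not (isAB x y)
  ; sym    = symP
  ; irrefl = irr }
  where
  isAB : Fin (order G) → Fin (order G) → Bool
  isAB x y = (⌊ x ≟ a ⌋ ∧ ⌊ y ≟ b ⌋) Data.Bool.∨ (⌊ x ≟ b ⌋ ∧ ⌊ y ≟ a ⌋)
  open import Data.Bool.Properties using (∧-comm; ∨-comm)
  open import Relation.Binary.PropositionalEquality using (cong₂; cong)
  symP : ∀ x y → (adj G x y ∧ not (isAB x y)) ≡ (adj G y x ∧ not (isAB y x))
  symP x y = cong₂ _∧_ (Graph.sym G x y)
    (cong not (Relation.Binary.PropositionalEquality.trans
      (∨-comm (⌊ x ≟ a ⌋ ∧ ⌊ y ≟ b ⌋) (⌊ x ≟ b ⌋ ∧ ⌊ y ≟ a ⌋))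
      (cong₂ Data.Bool._∨_ (∧-comm ⌊ x ≟ b ⌋ ⌊ y ≟ a ⌋) (∧-comm ⌊ x ≟ a ⌋ ⌊ y ≟ b ⌋))))
  irr : ∀ x → (adj G x x ∧ not (isAB x x)) ≡ false
  irr x = Relation.Binary.PropositionalEquality.cong (_∧ not (isAB x x)) (irrefl G x)

HasBridge : Graph → Set
HasBridge G = Σ (Fin (order G)) λ a → Σ (Fin (order G)) λ b →
  adj G a b ≡ true × ¬ Connected (deleteEdge G a b)

InClosedNbhd : (G : Graph) → Fin (order G) → Fin (order G) → Set
InClosedNbhd G v w = (w ≡ v) ⊎ (adj G v w ≡ true)

VSet : Graph → Set
VSet G = Fin (order G) → Bool

HasPrivateNeighbor : (G : Graph) → VSet G → Fin (order G) → Set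
HasPrivateNeighbor G S v = Σ (Fin (order G)) λ w →
  InClosedNbhd G v w ×
  (∀ u → S u ≡ true → u ≢ v → ¬ InClosedNbhd G u w)

Irredundant : (G : Graph) → VSet G → Set
Irredundant G S = ∀ v → S v ≡ true → HasPrivateNeighbor G S v

ProperColoring : (G : Graph) (k : ℕ) → (Fin (order G) → Fin k) → Set
ProperColoring G k c = ∀ u v → adj G u v ≡ true → c u ≢ c v

AllClassesNonempty : (G : Graph) (k : ℕ) → (Fin (order G) → Fin k) → Set
AllClassesNonempty G k c = ∀ i → ∃ λ v → c v ≡ i

-- S contains exactly one vertex of each color class (every vertex has a
-- color, so S contains nothing else).
RainbowCommittee : (G : Graph) (k : ℕ) → (Fin (order G) → Fin k) → VSet G → Set
RainbowCommittee G k c S = ∀ i → Σ (Fin (order G)) λ v →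
  S v ≡ true × c v ≡ i × (∀ w → S w ≡ true → c w ≡ i → w ≡ v)

IsIRCColoring : (G : Graph) (k : ℕ) → (Fin (order G) → Fin k) → Set
IsIRCColoring G k c =
  ProperColoring G k c × AllClassesNonempty G k c ×
  (∀ S → RainbowCommittee G k c S → Irredundant G S)

HasIRCColoring : Graph → Set
HasIRCColoring G = Σ ℕ λ k → Σ (Fin (order G) → Fin k) λ c → IsIRCColoring G k c

{-# OPTIONS --safe #-}
module Submission where

-- In a proper 2-colouring a rainbow committee is a pair {v, b} of differently
-- coloured vertices. If v and b are not adjacent, v is its own private
-- neighbour; if they are and v has a second neighbour w, then w has the colour
-- of b, so it is a private neighbour of v. Hence every 2-colourable graph of
-- minimum degree at least 2 has an IRC-colouring, and the graphs obtained by
-- joining a 4-cycle with a bridge to K(2, m + 2) form an infinite family of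
-- such graphs with a bridge, distinguished by their orders.

open import Defs hiding (sym)
open import Data.Nat using (ℕ; suc; _+_)
open import Data.Nat.Properties using (+-cancelˡ-≡)
open import Data.Fin using (Fin; toℕ; _≟_; #_) renaming (zero to fz; suc to fs)
open import Data.Fin.Properties using (cantor-schröder-bernstein)
open import Data.Bool using (Bool; true; false; _∨_; _∧_; not)
open import Data.Bool.Properties using (∨-comm)
open import Data.Product using (Σ; _×_; _,_)
open import Data.Sum using (inj₁; inj₂)
open import Data.Empty using (⊥-elim)
open import Relation.Nullary using (¬_; yes; no)
open import Relation.Binary.PropositionalEquality
  using (_≡_; _≢_; refl; sym; trans; subst; cong; ≢-sym)
open import Function.Bundles using (Injection)
open import Function.Properties.Inverse using (↔⇒↣; ↔-sym)

module _ {G : Graph} where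

  _++ʷ_ : ∀ {u v w} → Walk G u v → Walk G v w → Walk G u w
  [] ++ʷ q = q
  (e ∷ p) ++ʷ q = e ∷ (p ++ʷ q)

  reverseʷ : ∀ {u v} → Walk G u v → Walk G v u
  reverseʷ [] = []
  reverseʷ (_∷_ {u} {w} e p) = reverseʷ p ++ʷ (subst (_≡ true) (Graph.sym G u w) e ∷ [])

  walks-to-hub⇒connected : ∀ h → (∀ u → Walk G u h) → Connected G
  walks-to-hub⇒connected h to-h u v = to-h u ++ʷ reverseʷ (to-h v)

  walk-preserves-closed : (P : Fin (order G) → Bool) →
    (∀ u w → P u ≡ true → adj G u w ≡ true → P w ≡ true) →
    ∀ {u v} → Walk G u v → P u ≡ true → P v ≡ true
  walk-preserves-closed P closed [] Pu = Pu
  walk-preserves-closed P closed (_∷_ {u} {w} e p) Pu =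
    walk-preserves-closed P closed p (closed u w Pu e)

  closed-set⇒¬connected : (P : Fin (order G) → Bool) →
    (∀ u w → P u ≡ true → adj G u w ≡ true → P w ≡ true) →
    ∀ {a b} → P a ≡ true → P b ≡ false → ¬ Connected G
  closed-set⇒¬connected P closed {a} {b} Pa Pb conn
    with () ← trans (sym Pb) (walk-preserves-closed P closed (conn a b) Pa)

≅⇒order≡ : ∀ {G H} → G ≅ H → order G ≡ order H
≅⇒order≡ (φ , _) = cantor-schröder-bernstein
  (Injection.injective (↔⇒↣ φ)) (Injection.injective (↔⇒↣ (↔-sym φ)))

TwoNeighbours : (G : Graph) → Fin (order G) → Set
TwoNeighbours G v = Σ (Fin (order G)) λ w₁ → Σ (Fin (order G)) λ w₂ →
  adj G v w₁ ≡ true × adj G v w₂ ≡ true × w₁ ≢ w₂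

neighbour-avoiding : ∀ {G v} → TwoNeighbours G v →
  ∀ b → Σ (Fin (order G)) λ w → adj G v w ≡ true × w ≢ b
neighbour-avoiding (w₁ , w₂ , e₁ , e₂ , w₁≢w₂) b with w₁ ≟ b
... | no w₁≢b = w₁ , e₁ , w₁≢b
... | yes refl = w₂ , e₂ , ≢-sym w₁≢w₂

otherColour : Fin 2 → Fin 2
otherColour fz = fs fz
otherColour (fs fz) = fz

otherColour-≢ : ∀ i → otherColour i ≢ i
otherColour-≢ fz ()
otherColour-≢ (fs fz) ()

Fin2-both-≢⇒≡ : ∀ {i j k : Fin 2} → i ≢ k → j ≢ k → i ≡ j
Fin2-both-≢⇒≡ {fz} {fz} _ _ = refl
Fin2-both-≢⇒≡ {fs fz} {fs fz} _ _ = refl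
Fin2-both-≢⇒≡ {fz} {fs fz} {fz} i≢k _ = ⊥-elim (i≢k refl)
Fin2-both-≢⇒≡ {fz} {fs fz} {fs fz} _ j≢k = ⊥-elim (j≢k refl)
Fin2-both-≢⇒≡ {fs fz} {fz} {fz} _ j≢k = ⊥-elim (j≢k refl)
Fin2-both-≢⇒≡ {fs fz} {fz} {fs fz} i≢k _ = ⊥-elim (i≢k refl)

module TwoColouring (G : Graph) (c : Fin (order G) → Fin 2)
                    (proper : ProperColoring G 2 c) where

  private
    V = Fin (order G)

  private-neighbour-against : ∀ {v b} → TwoNeighbours G v → c v ≢ c b →
    Σ V λ w → InClosedNbhd G v w × ¬ InClosedNbhd G b w
  private-neighbour-against {v} {b} two cv≢cb with adj G v b in vb
  ... | false = v , inj₁ refl , v∉N[b]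
    where
    v∉N[b] : ¬ InClosedNbhd G b v
    v∉N[b] (inj₁ v≡b) = cv≢cb (cong c v≡b)
    v∉N[b] (inj₂ bv) with () ← trans (sym vb) (trans (Graph.sym G v b) bv)
  ... | true with neighbour-avoiding {G} two b
  ... | w , vw , w≢b = w , inj₂ vw , w∉N[b]
    where
    w∉N[b] : ¬ InClosedNbhd G b w
    w∉N[b] (inj₁ w≡b) = w≢b w≡b
    w∉N[b] (inj₂ bw) = proper b w bw
      (Fin2-both-≢⇒≡ (≢-sym cv≢cb) (≢-sym (proper v w vw)))

  committee-others-share-colour : ∀ {S v b} → RainbowCommittee G 2 c S →
    S v ≡ true → S b ≡ true → c b ≡ otherColour (c v) →
    ∀ u → S u ≡ true → u ≢ v → u ≡ b
  committee-others-share-colour {v = v} {b} R Sv Sb cb u Su u≢v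
    with R (c v) | R (c b)
  ... | _ , _ , _ , unique-a | b′ , _ , _ , unique-b′
    with c u ≟ c v
  ... | yes cu≡cv =
    ⊥-elim (u≢v (trans (unique-a u Su cu≡cv) (sym (unique-a v Sv refl))))
  ... | no cu≢cv =
    trans (unique-b′ u Su cu≡cb) (sym (unique-b′ b Sb refl))
    where
    cu≡cb = Fin2-both-≢⇒≡ cu≢cv (subst (_≢ c v) (sym cb) (otherColour-≢ (c v)))

  min-degree-two⇒IRC : (∀ v → TwoNeighbours G v) → AllClassesNonempty G 2 c →
    IsIRCColoring G 2 c
  min-degree-two⇒IRC two nonempty = proper , nonempty , irredundant
    where
    irredundant : ∀ S → RainbowCommittee G 2 c S → Irredundant G S
    irredundant S R v Sv with R (otherColour (c v))
    ... | b , Sb , cb , _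
      with private-neighbour-against (two v)
             (λ cv≡cb → otherColour-≢ (c v) (trans (sym cb) (sym cv≡cb)))
    ... | w , v∼w , b≁w = w , v∼w , λ u Su u≢v →
      subst (λ x → ¬ InClosedNbhd G x w)
        (sym (committee-others-share-colour R Sv Sb cb u Su u≢v)) b≁w

crosses : (ℕ → Bool) → (ℕ → ℕ → Bool) → ℕ → ℕ → Bool
crosses side link x y = side x ∧ not (side y) ∧ link x y

crosses-sides : ∀ side link x y → crosses side link x y ≡ true →
  side x ≡ true × side y ≡ false
crosses-sides side link x y e with side x | side y
crosses-sides side link x y () | false | _
crosses-sides side link x y () | true | true
crosses-sides side link x y _ | true | false = refl , refl

crosses-irrefl : ∀ side link x → crosses side link x x ≡ false
crosses-irrefl side link x with side x
... | false = refl
... | true = refl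

bipartiteGraph : ℕ → (side : ℕ → Bool) → (link : ℕ → ℕ → Bool) → Graph
bipartiteGraph n side link = record
  { order  = n
  ; adj    = λ u v → arc u v ∨ arc v u
  ; sym    = λ u v → ∨-comm (arc u v) (arc v u)
  ; irrefl = λ v → cong (λ b → b ∨ b) (crosses-irrefl side link (toℕ v)) }
  where
  arc : Fin n → Fin n → Bool
  arc u v = crosses side link (toℕ u) (toℕ v)

sideColour : Bool → Fin 2
sideColour true = fz
sideColour false = fs fz

sides-differ : ∀ {a b} → a ≡ true × b ≡ false → sideColour a ≢ sideColour b
sides-differ (refl , refl) ()

module _ (n : ℕ) (side : ℕ → Bool) (link : ℕ → ℕ → Bool) where

  sideColouring : Fin n → Fin 2
  sideColouring u = sideColour (side (toℕ u))

  sideColouring-proper : ProperColoring (bipartiteGraph n side link) 2 sideColouring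
  sideColouring-proper u v uv with crosses side link (toℕ u) (toℕ v) in e
  ... | true = sides-differ (crosses-sides side link (toℕ u) (toℕ v) e)
  ... | false = ≢-sym (sides-differ (crosses-sides side link (toℕ v) (toℕ u) uv))

cycleSide : ℕ → Bool
cycleSide 0 = true
cycleSide 1 = true
cycleSide 4 = true
cycleSide 5 = true
cycleSide _ = false

-- The 4-cycle 0–2–1–3, the bridge 3–4, and the complete bipartite graph with
-- parts {4, 5} and {6, 7, …}.
bridgedLink : ℕ → ℕ → Bool
bridgedLink 0 2 = true
bridgedLink 0 3 = true
bridgedLink 1 2 = true
bridgedLink 1 3 = true
bridgedLink 4 3 = true
bridgedLink 4 (suc (suc (suc (suc (suc (suc _)))))) = true
bridgedLink 5 (suc (suc (suc (suc (suc (suc _)))))) = true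
bridgedLink _ _ = false

bridgedGraph : ℕ → Graph
bridgedGraph m = bipartiteGraph (8 + m) cycleSide bridgedLink

bridgedColouring : (m : ℕ) → Fin (8 + m) → Fin 2
bridgedColouring m = sideColouring (8 + m) cycleSide bridgedLink

module _ (m : ℕ) where

  private
    G = bridgedGraph m
    V = Fin (8 + m)

  walk-to-3 : ∀ u → Walk G u (# 3)
  walk-to-3 fz = refl ∷ []
  walk-to-3 (fs fz) = refl ∷ []
  walk-to-3 (fs (fs fz)) = _∷_ {w = # 0} refl (refl ∷ [])
  walk-to-3 (fs (fs (fs fz))) = []
  walk-to-3 (fs (fs (fs (fs fz)))) = refl ∷ []
  walk-to-3 (fs (fs (fs (fs (fs fz))))) =
    _∷_ {w = # 6} refl (_∷_ {w = # 4} refl (refl ∷ []))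
  walk-to-3 (fs (fs (fs (fs (fs (fs _)))))) = _∷_ {w = # 4} refl (refl ∷ [])

  inCycle : V → Bool
  inCycle (fs (fs (fs (fs _)))) = false
  inCycle _ = true

  -- 3–4 is the only edge between {0, 1, 2, 3} and the rest.
  cycle-closed : ∀ u w → inCycle u ≡ true →
    adj (deleteEdge G (# 3) (# 4)) u w ≡ true → inCycle w ≡ true
  cycle-closed (fs (fs (fs (fs _)))) _ () _
  cycle-closed _ fz _ _ = refl
  cycle-closed _ (fs fz) _ _ = refl
  cycle-closed _ (fs (fs fz)) _ _ = refl
  cycle-closed _ (fs (fs (fs fz))) _ _ = refl
  cycle-closed fz (fs (fs (fs (fs fz)))) _ ()
  cycle-closed fz (fs (fs (fs (fs (fs fz))))) _ ()
  cycle-closed fz (fs (fs (fs (fs (fs (fs _)))))) _ ()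
  cycle-closed (fs fz) (fs (fs (fs (fs fz)))) _ ()
  cycle-closed (fs fz) (fs (fs (fs (fs (fs fz))))) _ ()
  cycle-closed (fs fz) (fs (fs (fs (fs (fs (fs _)))))) _ ()
  cycle-closed (fs (fs fz)) (fs (fs (fs (fs fz)))) _ ()
  cycle-closed (fs (fs fz)) (fs (fs (fs (fs (fs fz))))) _ ()
  cycle-closed (fs (fs fz)) (fs (fs (fs (fs (fs (fs _)))))) _ ()
  cycle-closed (fs (fs (fs fz))) (fs (fs (fs (fs fz)))) _ ()
  cycle-closed (fs (fs (fs fz))) (fs (fs (fs (fs (fs fz))))) _ ()
  cycle-closed (fs (fs (fs fz))) (fs (fs (fs (fs (fs (fs _)))))) _ ()

  bridgedGraph-connected : Connected G
  bridgedGraph-connected = walks-to-hub⇒connected (# 3) walk-to-3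

  bridgedGraph-bridge : HasBridge G
  bridgedGraph-bridge = # 3 , # 4 , refl ,
    closed-set⇒¬connected inCycle cycle-closed {# 0} {# 4} refl refl

  two-neighbours : ∀ v → TwoNeighbours G v
  two-neighbours fz = # 2 , # 3 , refl , refl , λ ()
  two-neighbours (fs fz) = # 2 , # 3 , refl , refl , λ ()
  two-neighbours (fs (fs fz)) = # 0 , # 1 , refl , refl , λ ()
  two-neighbours (fs (fs (fs fz))) = # 0 , # 1 , refl , refl , λ ()
  two-neighbours (fs (fs (fs (fs fz)))) = # 3 , # 6 , refl , refl , λ ()
  two-neighbours (fs (fs (fs (fs (fs fz))))) = # 6 , # 7 , refl , refl , λ ()
  two-neighbours (fs (fs (fs (fs (fs (fs _)))))) = # 4 , # 5 , refl , refl , λ ()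

  bridgedColouring-classes-nonempty : AllClassesNonempty G 2 (bridgedColouring m)
  bridgedColouring-classes-nonempty fz = # 0 , refl
  bridgedColouring-classes-nonempty (fs fz) = # 2 , refl

  bridgedGraph-IRC : HasIRCColoring G
  bridgedGraph-IRC = 2 , bridgedColouring m ,
    TwoColouring.min-degree-two⇒IRC G (bridgedColouring m)
      (sideColouring-proper (8 + m) cycleSide bridgedLink)
      two-neighbours bridgedColouring-classes-nonempty

theorem6 : Σ (ℕ → Graph) λ F →
    (∀ i → Connected (F i) × HasBridge (F i) × HasIRCColoring (F i)) ×
    (∀ i j → i ≢ j → ¬ (F i ≅ F j))
theorem6 = bridgedGraph ,
  (λ i → bridgedGraph-connected i , bridgedGraph-bridge i , bridgedGraph-IRC i) ,
  λ i j i≢j Fi≅Fj →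
    i≢j (+-cancelˡ-≡ 8 i j (≅⇒order≡ {bridgedGraph i} {bridgedGraph j} Fi≅Fj))
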